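{- Let $q=2^r$ and for $\beta\in\mathbb{F}_q$ let $n(\beta)=|\{w\in O(3,q): Tr\, w=\beta\}|$. Then \[ n(\beta)=\begin{cases} q^2, & \text{if } \beta=1,\\ q^2+q, & \text{if } \beta\neq 1 \text{ and } tr((\beta-1)^{ -1})=0,\\ q^2-q, & \text{if } \beta\neq 1\text{ and } tr((\beta-1)^{ -1})=1.\end{cases} \]
   Context: $q=2^r$ with $r\ge 1$; $\mathbb{F}_q$ is the field with $q$ elements; $tr(x)=x+x^2+\cdots+x^{2^{r-1}}$ is the absolute trace $\mathbb{F}_q\to\mathbb{F}_2$. $O(3,q)$ is the group of all $w\in GL(3,q)$ preserving the nondegenerate quadratic form $\theta(x_1,x_2,x_3)=x_1x_2+x_3^2$ on column vectors $\mathbb{F}_q^{3\times 1}$; concretely it consists of the matrices $\begin{bmatrix} a&b&0\\ c&d&0\\ g&h&1\end{bmatrix}\in GL(3,q)$ with $ac+g^2=0$, $bd+h^2=0$, $ad+bc=1$. $Tr\,w$ is the matrix trace. -}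

module Defs where

open import Data.Nat using (ℕ; zero; suc; _^_)
open import Data.Fin using (Fin)
open import Data.Fin.Properties using () renaming (_≟_ to _≟ᶠ_)
open import Data.List using (List; []; _∷_; map; concatMap; filter; length; allFin)
open import Data.Vec using (Vec; []; _∷_; lookup)
open import Data.Product using (_×_; _,_)
open import Relation.Binary.PropositionalEquality using (_≡_; _≢_; cong; sym; trans)
open import Relation.Nullary using (Dec; yes; no; ¬_; ¬?)
open import Relation.Nullary.Decidable using (_×-dec_; map′)
open import Function.Bundles using (_↔_; Inverse)
import Algebra.Structures as S

record GF (r : ℕ) : Set₁ where
  infixl 6 _+_ _-_
  infixl 7 _*_
  infix 4 _≟_
  field
    Carrier : Set
    _+_ _*_ : Carrier → Carrier → Carrier
    -_ : Carrier → Carrier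
    0# 1# : Carrier
    isCommutativeRing : S.IsCommutativeRing _≡_ _+_ _*_ -_ 0# 1#
    0≢1 : 0# ≢ 1#
    _⁻¹ : Carrier → Carrier
    inverse : ∀ x → x ≢ 0# → x * (x ⁻¹) ≡ 1#
    -- characteristic 2 (a consequence of |F| = 2^r, recorded for convenience)
    char2 : 1# + 1# ≡ 0#
    enum : Carrier ↔ Fin (2 ^ r)

  q : ℕ
  q = 2 ^ r

  _-_ : Carrier → Carrier → Carrier
  x - y = x + (- y)

  toFin : Carrier → Fin q
  toFin = Inverse.to enum

  fromFin : Fin q → Carrier
  fromFin = Inverse.from enum

  _≟_ : (x y : Carrier) → Dec (x ≡ y)
  x ≟ y = map′ (λ e → begin-eq e) (cong toFin) (toFin x ≟ᶠ toFin y)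
    where
    begin-eq : toFin x ≡ toFin y → x ≡ y
    begin-eq e = trans (sym (Inverse.strictlyInverseʳ enum x)) (trans (cong fromFin e) (Inverse.strictlyInverseʳ enum y))

  elements : List Carrier
  elements = map fromFin (allFin q)

  _^′_ : Carrier → ℕ → Carrier
  x ^′ zero = 1#
  x ^′ suc n = x * (x ^′ n)

  trUpTo : ℕ → Carrier → Carrier
  trUpTo zero x = 0#
  trUpTo (suc k) x = trUpTo k x + (x ^′ (2 ^ k))

  tr : Carrier → Carrier
  tr = trUpTo r

  Mat3 : Set
  Mat3 = Vec (Vec Carrier 3) 3

  _[_,_] : Mat3 → Fin 3 → Fin 3 → Carrier
  m [ i , j ] = lookup (lookup m i) j

  allVec3 : List (Vec Carrier 3)
  allVec3 = concatMap (λ x → concatMap (λ y → map (λ z → x ∷ y ∷ z ∷ []) elements) elements) elements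

  allMat3 : List Mat3
  allMat3 = concatMap (λ u → concatMap (λ v → map (λ w → u ∷ v ∷ w ∷ []) allVec3) allVec3) allVec3

  det : Mat3 → Carrier
  det (  (a₁ ∷ a₂ ∷ a₃ ∷ [])
       ∷ (b₁ ∷ b₂ ∷ b₃ ∷ [])
       ∷ (c₁ ∷ c₂ ∷ c₃ ∷ []) ∷ []) =
    a₁ * (b₂ * c₃ - b₃ * c₂) - a₂ * (b₁ * c₃ - b₃ * c₁) + a₃ * (b₁ * c₂ - b₂ * c₁)

  Tr : Mat3 → Carrier
  Tr (  (a₁ ∷ _ ∷ _ ∷ [])
      ∷ (_ ∷ b₂ ∷ _ ∷ [])
      ∷ (_ ∷ _ ∷ c₃ ∷ []) ∷ []) = a₁ + b₂ + c₃

  InO3 : Mat3 → Set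
  InO3 w@(  (a ∷ b ∷ e₁ ∷ [])
          ∷ (c ∷ d ∷ e₂ ∷ [])
          ∷ (g ∷ h ∷ e₃ ∷ []) ∷ []) =
    (e₁ ≡ 0#) × (e₂ ≡ 0#) × (e₃ ≡ 1#) ×
    (a * c + g * g ≡ 0#) × (b * d + h * h ≡ 0#) × (a * d + b * c ≡ 1#) ×
    (det w ≢ 0#)

  InO3? : (w : Mat3) → Dec (InO3 w)
  InO3? w@(  (a ∷ b ∷ e₁ ∷ [])
           ∷ (c ∷ d ∷ e₂ ∷ [])
           ∷ (g ∷ h ∷ e₃ ∷ []) ∷ []) =
    (e₁ ≟ 0#) ×-dec (e₂ ≟ 0#) ×-dec (e₃ ≟ 1#) ×-dec
    ((a * c + g * g) ≟ 0#) ×-dec ((b * d + h * h) ≟ 0#) ×-dec ((a * d + b * c) ≟ 1#) ×-dec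
    ¬? (det w ≟ 0#)

  InO3Tr : Carrier → Mat3 → Set
  InO3Tr β w = InO3 w × (Tr w ≡ β)

  InO3Tr? : (β : Carrier) → (w : Mat3) → Dec (InO3Tr β w)
  InO3Tr? β w = InO3? w ×-dec (Tr w ≟ β)

  n : Carrier → ℕ
  n β = length (filter (InO3Tr? β) allMat3)

{-# OPTIONS --safe #-}

-- In w ∈ O(3,q) the third row is forced: g = √(ac) and h = √(bd), squaring
-- being bijective in characteristic 2, and the trace condition gives d = a + t with
-- t = β + 1. Hence n(β) counts the triples (a, b, c) with b c = 1 + a (a + t). As b c = k
-- has q - 1 solutions for k ≠ 0 and 2q - 1 for k = 0, this gives n(β) + q = q N + q²,
-- where N is the number of roots of a (a + t) = 1. For t = 0 the only root is 1. For
-- t ≠ 0 the substitution a = t y turns the equation into y² + y = t⁻², which has two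
-- or no solutions according as tr(t⁻²) = tr(t⁻¹) is 0 or 1, because the image of
-- y ↦ y² + y is exactly the kernel of tr (tr being a polynomial of degree q/2).

module Submission where

open import Defs
open import Level using (Level)
open import Algebra.Bundles using (CommutativeMonoid; CommutativeRing)
import Algebra.Properties.CommutativeMonoid.Sum as MonoidSum
import Algebra.Properties.Semiring.Sum as SemiringSum
open import Data.Bool using (if_then_else_)
open import Data.Empty using (⊥-elim)
open import Data.Fin using (Fin; zero; suc)
import Data.Fin.Properties as Finₚ
open import Data.List as List using (List; []; _∷_; _++_; filter; length; concatMap; tabulate)
import Data.List.Properties as Listₚ
open import Data.Maybe using (nothing)
open import Data.Nat using (ℕ; zero; suc; _≤_; _<_; z≤n; s≤s)
import Data.Nat as ℕ
open import Data.Nat.ListAction using () renaming (sum to sumˡ)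
open import Data.Nat.ListAction.Properties using (sum-++)
import Data.Nat.Properties as ℕₚ
open import Data.Nat.Solver using (module +-*-Solver)
open import Data.Product using (_×_; ∃; ∃₂; _,_)
open import Data.Sum using (_⊎_; inj₁; inj₂; [_,_]; map₁)
open import Data.Vec using (Vec; []; _∷_)
open import Data.Vec.Functional using (Vector)
open import Function using (_∘_; id; _↔_; Inverse; _⇔_; Equivalence; mk⇔; mk↔ₛ′)
open import Function.Properties.Inverse using (↔-sym; ↔-trans)
open import Relation.Binary.PropositionalEquality
  using (_≡_; _≢_; refl; sym; trans; cong; cong₂; subst; module ≡-Reasoning)
open import Relation.Nullary using (Dec; yes; no; does; ¬_)
open import Relation.Nullary.Decidable using (dec-true; dec-false; does-⇔; map′)
open import Relation.Unary using (Pred; Decidable)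
open import Tactic.RingSolver.Core.AlmostCommutativeRing using (fromCommutativeRing)

private
  variable
    ℓ₁ ℓ₂ ℓ₃ : Level
    A : Set ℓ₁
    B : Set ℓ₂
    C : Set ℓ₃

𝟙 : Dec A → ℕ
𝟙 a? = if does a? then 1 else 0

𝟙-yes : (a? : Dec A) → A → 𝟙 a? ≡ 1
𝟙-yes a? x rewrite dec-true a? x = refl

𝟙-no : (a? : Dec A) → ¬ A → 𝟙 a? ≡ 0
𝟙-no a? ¬x rewrite dec-false a? ¬x = refl

𝟙-cong : A ⇔ B → (a? : Dec A) (b? : Dec B) → 𝟙 a? ≡ 𝟙 b?
𝟙-cong A⇔B a? b? = cong (λ t → if t then 1 else 0) (does-⇔ A⇔B a? b?)

𝟙-≤-+ : (A → B ⊎ C) → (a? : Dec A) (b? : Dec B) (c? : Dec C) → 𝟙 a? ≤ 𝟙 b? ℕ.+ 𝟙 c?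
𝟙-≤-+ _ (no _) _ _ = z≤n
𝟙-≤-+ _ (yes _) (yes _) _ = s≤s z≤n
𝟙-≤-+ _ (yes _) (no _) (yes _) = s≤s z≤n
𝟙-≤-+ split (yes x) (no ¬y) (no ¬z) = ⊥-elim ([ ¬y , ¬z ] (split x))

𝟙-+-≤ : (B → A) → (C → A) → ¬ (B × C) → (a? : Dec A) (b? : Dec B) (c? : Dec C) → 𝟙 b? ℕ.+ 𝟙 c? ≤ 𝟙 a?
𝟙-+-≤ _ _ _ _ (no _) (no _) = z≤n
𝟙-+-≤ _ _ disjoint _ (yes y) (yes z) = ⊥-elim (disjoint (y , z))
𝟙-+-≤ _ _ _ (yes _) (yes _) (no _) = s≤s z≤n
𝟙-+-≤ _ _ _ (yes _) (no _) (yes _) = s≤s z≤n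
𝟙-+-≤ B→A _ _ (no ¬x) (yes y) (no _) = ⊥-elim (¬x (B→A y))
𝟙-+-≤ _ C→A _ (no ¬x) (no _) (yes z) = ⊥-elim (¬x (C→A z))

length-filter≡sumˡ-𝟙 : {P : Pred A ℓ₂} (P? : Decidable P) (xs : List A) →
                      length (filter P? xs) ≡ sumˡ (List.map (𝟙 ∘ P?) xs)
length-filter≡sumˡ-𝟙 P? [] = refl
length-filter≡sumˡ-𝟙 P? (x ∷ xs) with P? x
... | yes _ = cong suc (length-filter≡sumˡ-𝟙 P? xs)
... | no _ = length-filter≡sumˡ-𝟙 P? xs

sumˡ-map-concatMap : (f : B → ℕ) (g : A → List B) (xs : List A) →
                    sumˡ (List.map f (concatMap g xs))
                    ≡ sumˡ (List.map (λ x → sumˡ (List.map f (g x))) xs)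
sumˡ-map-concatMap f g [] = refl
sumˡ-map-concatMap f g (x ∷ xs) = begin
  sumˡ (List.map f (g x ++ concatMap g xs))
    ≡⟨ cong sumˡ (Listₚ.map-++ f (g x) (concatMap g xs)) ⟩
  sumˡ (List.map f (g x) ++ List.map f (concatMap g xs))
    ≡⟨ sum-++ (List.map f (g x)) _ ⟩
  sumˡ (List.map f (g x)) ℕ.+ sumˡ (List.map f (concatMap g xs))
    ≡⟨ cong (sumˡ (List.map f (g x)) ℕ.+_) (sumˡ-map-concatMap f g xs) ⟩
  sumˡ (List.map (λ x → sumˡ (List.map f (g x))) (x ∷ xs)) ∎
  where open ≡-Reasoning

sumˡ-map-triples : (xs : List A) (k : A → A → A → B) (f : B → ℕ) →
  sumˡ (List.map f (concatMap (λ x → concatMap (λ y → List.map (k x y) xs) xs) xs))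
  ≡ sumˡ (List.map (λ x → sumˡ (List.map (λ y → sumˡ (List.map (f ∘ k x y) xs)) xs)) xs)
sumˡ-map-triples xs k f =
  trans (sumˡ-map-concatMap f _ xs)
        (cong sumˡ (Listₚ.map-cong (λ x →
           trans (sumˡ-map-concatMap f _ xs)
                 (cong sumˡ (Listₚ.map-cong (λ y → cong sumˡ (sym (Listₚ.map-∘ xs))) xs))) xs))

module ℕSum = SemiringSum ℕₚ.+-*-semiring

sumˡ-map-tabulate : ∀ {n} (f : A → ℕ) (g : Fin n → A) →
                   sumˡ (List.map f (tabulate g)) ≡ ℕSum.sum (f ∘ g)
sumˡ-map-tabulate {n = zero} f g = refl
sumˡ-map-tabulate {n = suc n} f g = cong (f (g zero) ℕ.+_) (sumˡ-map-tabulate f (g ∘ suc))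

sum-const : ∀ n k → ℕSum.sum {n} (λ _ → k) ≡ n ℕ.* k
sum-const zero k = refl
sum-const (suc n) k = cong (k ℕ.+_) (sum-const n k)

sum-mono-≤ : ∀ {n} {f g : Vector ℕ n} → (∀ i → f i ≤ g i) → ℕSum.sum f ≤ ℕSum.sum g
sum-mono-≤ {zero} _ = z≤n
sum-mono-≤ {suc n} f≤g = ℕₚ.+-mono-≤ (f≤g zero) (sum-mono-≤ (f≤g ∘ suc))

sum-mono-< : ∀ {n} {f g : Vector ℕ n} → (∀ i → f i ≤ g i) → ∀ i → f i < g i → ℕSum.sum f < ℕSum.sum g
sum-mono-< f≤g zero f<g = ℕₚ.+-mono-<-≤ f<g (sum-mono-≤ (f≤g ∘ suc))
sum-mono-< f≤g (suc i) f<g = ℕₚ.+-mono-≤-< (f≤g zero) (sum-mono-< (f≤g ∘ suc) i f<g)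

module _ (M : CommutativeMonoid ℓ₁ ℓ₂) where
  open CommutativeMonoid M using (Carrier; _≈_; ε; ∙-congˡ; identityʳ) renaming (trans to ≈-trans)
  open MonoidSum M using (sum; sum-remove; sum-cong-≋; sum-replicate-zero)

  sum-single : ∀ {n} (t : Vector Carrier n) i → (∀ j → j ≢ i → t j ≈ ε) → sum t ≈ t i
  sum-single {suc n} t i t≈ε =
    ≈-trans (sum-remove {i = i} t)
            (≈-trans (∙-congˡ (≈-trans (sum-cong-≋ (λ j → t≈ε _ (Finₚ.punchInᵢ≢i i j))) (sum-replicate-zero n)))
                     (identityʳ (t i)))

module FiniteSum {A : Set ℓ₁} {n : ℕ} (enum : A ↔ Fin n) (M : CommutativeMonoid ℓ₂ ℓ₃) where
  open CommutativeMonoid M using (Carrier; _≈_; _∙_; ε) renaming (trans to ≈-trans; reflexive to ≈-reflexive)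
  open MonoidSum M using (sum; sum-cong-≋; sum-cong-≗; ∑-distrib-+; ∑-comm; sum-permute)
  open Inverse enum using (to; from; strictlyInverseˡ; strictlyInverseʳ)

  ⨁ : (A → Carrier) → Carrier
  ⨁ f = sum (f ∘ from)

  ⨁-cong : {f g : A → Carrier} → (∀ x → f x ≈ g x) → ⨁ f ≈ ⨁ g
  ⨁-cong f≈g = sum-cong-≋ (f≈g ∘ from)

  ⨁-distrib : (f g : A → Carrier) → ⨁ (λ x → f x ∙ g x) ≈ ⨁ f ∙ ⨁ g
  ⨁-distrib f g = ∑-distrib-+ (f ∘ from) (g ∘ from)

  ⨁-comm : (h : A → A → Carrier) → ⨁ (λ x → ⨁ (h x)) ≈ ⨁ (λ y → ⨁ (λ x → h x y))
  ⨁-comm h = ∑-comm (λ i j → h (from i) (from j))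

  ⨁-single : (c : A) (f : A → Carrier) → (∀ x → x ≢ c → f x ≈ ε) → ⨁ f ≈ f c
  ⨁-single c f f≈ε =
    ≈-trans (sum-single M (f ∘ from) (to c)
                        (λ j j≢c → f≈ε (from j) (λ e → j≢c (trans (sym (strictlyInverseˡ j)) (cong to e)))))
            (≈-reflexive (cong f (strictlyInverseʳ c)))

  ⨁-bijection : (σ : A ↔ A) (f : A → Carrier) → ⨁ f ≈ ⨁ (f ∘ Inverse.to σ)
  ⨁-bijection σ f =
    ≈-trans (sum-permute (f ∘ from) (↔-trans (↔-sym enum) (↔-trans σ enum)))
            (≈-reflexive (sum-cong-≗ {n} (λ i → cong f (strictlyInverseʳ (Inverse.to σ (from i))))))

module FiniteField {r : ℕ} (F : GF r) where
  open GF F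

  commutativeRing : CommutativeRing _ _
  commutativeRing = record { isCommutativeRing = isCommutativeRing }

  open CommutativeRing commutativeRing public
    using ( +-comm; +-assoc; *-comm; *-assoc; distribˡ; distribʳ; +-identityˡ; +-identityʳ
          ; *-identityˡ; *-identityʳ; zeroˡ; zeroʳ; -‿inverseʳ; *-commutativeMonoid)
  open import Tactic.RingSolver.NonReflective (fromCommutativeRing commutativeRing (λ _ → nothing)) public
    using (solve; _⊜_; _⊕_; _⊗_)
  open Inverse enum using (strictlyInverseʳ)

  x+x≡0 : ∀ x → x + x ≡ 0#
  x+x≡0 x = begin
    x + x             ≡⟨ sym (cong₂ _+_ (*-identityʳ x) (*-identityʳ x)) ⟩
    x * 1# + x * 1#   ≡⟨ sym (distribˡ x 1# 1#) ⟩
    x * (1# + 1#)     ≡⟨ cong (x *_) char2 ⟩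
    x * 0#            ≡⟨ zeroʳ x ⟩
    0#                ∎
    where open ≡-Reasoning

  x+y≡z⇒x≡z+y : ∀ {x y z} → x + y ≡ z → x ≡ z + y
  x+y≡z⇒x≡z+y {x} {y} {z} x+y≡z = begin
    x             ≡⟨ sym (+-identityʳ x) ⟩
    x + 0#        ≡⟨ cong (x +_) (sym (x+x≡0 y)) ⟩
    x + (y + y)   ≡⟨ sym (+-assoc x y y) ⟩
    (x + y) + y   ≡⟨ cong (_+ y) x+y≡z ⟩
    z + y         ∎
    where open ≡-Reasoning

  x+y≡z⇔x≡z+y : ∀ {x y z} → (x + y ≡ z) ⇔ (x ≡ z + y)
  x+y≡z⇔x≡z+y = mk⇔ x+y≡z⇒x≡z+y (λ x≡z+y → sym (x+y≡z⇒x≡z+y (sym x≡z+y)))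

  x+y≡0⇒x≡y : ∀ {x y} → x + y ≡ 0# → x ≡ y
  x+y≡0⇒x≡y {y = y} x+y≡0 = trans (x+y≡z⇒x≡z+y x+y≡0) (+-identityˡ y)

  x+y≡0⇔x≡y : ∀ {x y} → (x + y ≡ 0#) ⇔ (x ≡ y)
  x+y≡0⇔x≡y {y = y} = mk⇔ x+y≡0⇒x≡y (λ { refl → x+x≡0 y })

  x-y≡x+y : ∀ x y → x - y ≡ x + y
  x-y≡x+y x y = cong (x +_) (sym (x+y≡0⇒x≡y (-‿inverseʳ y)))

  [x+y]²≡x²+y² : ∀ x y → (x + y) * (x + y) ≡ x * x + y * y
  [x+y]²≡x²+y² x y = begin
    (x + y) * (x + y)                    ≡⟨ expand x y ⟩
    x * x + y * y + (x * y + x * y)      ≡⟨ cong (x * x + y * y +_) (x+x≡0 (x * y)) ⟩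
    x * x + y * y + 0#                   ≡⟨ +-identityʳ _ ⟩
    x * x + y * y                        ∎
    where
    open ≡-Reasoning
    expand : ∀ x y → (x + y) * (x + y) ≡ x * x + y * y + (x * y + x * y)
    expand = solve 2 (λ x y → (x ⊕ y) ⊗ (x ⊕ y) ⊜ (x ⊗ x ⊕ y ⊗ y ⊕ (x ⊗ y ⊕ x ⊗ y))) refl

  1≢0 : 1# ≢ 0#
  1≢0 = 0≢1 ∘ sym

  x⁻¹*[x*y]≡y : ∀ {x} → x ≢ 0# → ∀ y → x ⁻¹ * (x * y) ≡ y
  x⁻¹*[x*y]≡y {x} x≢0 y = begin
    x ⁻¹ * (x * y)   ≡⟨ sym (*-assoc (x ⁻¹) x y) ⟩
    x ⁻¹ * x * y     ≡⟨ cong (_* y) (trans (*-comm (x ⁻¹) x) (inverse x x≢0)) ⟩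
    1# * y           ≡⟨ *-identityˡ y ⟩
    y                ∎
    where open ≡-Reasoning

  x*[x⁻¹*y]≡y : ∀ {x} → x ≢ 0# → ∀ y → x * (x ⁻¹ * y) ≡ y
  x*[x⁻¹*y]≡y {x} x≢0 y = begin
    x * (x ⁻¹ * y)   ≡⟨ sym (*-assoc x (x ⁻¹) y) ⟩
    x * x ⁻¹ * y     ≡⟨ cong (_* y) (inverse x x≢0) ⟩
    1# * y           ≡⟨ *-identityˡ y ⟩
    y                ∎
    where open ≡-Reasoning

  x*y≡0⇒x≡0⊎y≡0 : ∀ {x y} → x * y ≡ 0# → x ≡ 0# ⊎ y ≡ 0#
  x*y≡0⇒x≡0⊎y≡0 {x} {y} x*y≡0 with x ≟ 0#
  ... | yes x≡0 = inj₁ x≡0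
  ... | no x≢0 = inj₂ (trans (sym (x⁻¹*[x*y]≡y x≢0 y)) (trans (cong (x ⁻¹ *_) x*y≡0) (zeroʳ (x ⁻¹))))

  x≢0∧y≢0⇒x*y≢0 : ∀ {x y} → x ≢ 0# → y ≢ 0# → x * y ≢ 0#
  x≢0∧y≢0⇒x*y≢0 x≢0 y≢0 x*y≡0 = [ x≢0 , y≢0 ] (x*y≡0⇒x≡0⊎y≡0 x*y≡0)

  x*x≡y*y⇒x≡y : ∀ {x y} → x * x ≡ y * y → x ≡ y
  x*x≡y*y⇒x≡y {x} {y} x²≡y² =
    x+y≡0⇒x≡y ([ id , id ] (x*y≡0⇒x≡0⊎y≡0 (trans ([x+y]²≡x²+y² x y) (trans (cong (_+ y * y) x²≡y²) (x+x≡0 _)))))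

  ∃? : {P : Pred Carrier ℓ₁} → Decidable P → Dec (∃ P)
  ∃? {P = P} P? =
    map′ (λ { (i , Pi) → fromFin i , Pi })
         (λ { (x , Px) → toFin x , subst P (sym (strictlyInverseʳ x)) Px })
         (Finₚ.any? (P? ∘ fromFin))

  open FiniteSum enum ℕₚ.+-0-commutativeMonoid public
    using () renaming (⨁ to ∑; ⨁-cong to ∑-cong; ⨁-distrib to ∑-distrib; ⨁-comm to ∑-comm; ⨁-single to ∑-single)

  ∑-const : ∀ k → ∑ (λ _ → k) ≡ q ℕ.* k
  ∑-const = sum-const q

  ∑-* : ∀ k f → ∑ (λ x → k ℕ.* f x) ≡ k ℕ.* ∑ f
  ∑-* k f = sym (ℕSum.*-distribˡ-sum k (f ∘ fromFin))

  ∑-mono-≤ : ∀ {f g} → (∀ x → f x ≤ g x) → ∑ f ≤ ∑ g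
  ∑-mono-≤ f≤g = sum-mono-≤ (f≤g ∘ fromFin)

  ∑-mono-< : ∀ {f g} → (∀ x → f x ≤ g x) → ∀ c → f c < g c → ∑ f < ∑ g
  ∑-mono-< {f} {g} f≤g c f<g =
    sum-mono-< (f≤g ∘ fromFin) (toFin c)
               (subst (λ x → f x < g x) (sym (strictlyInverseʳ c)) f<g)

  ∑-𝟙-unique : {P : Pred Carrier ℓ₁} (P? : Decidable P) (c : Carrier) →
               (∀ {x} → P x → x ≡ c) → ∑ (𝟙 ∘ P?) ≡ 𝟙 (P? c)
  ∑-𝟙-unique P? c unique = ∑-single c (𝟙 ∘ P?) (λ x x≢c → 𝟙-no (P? x) (x≢c ∘ unique))

  ∑-𝟙-≟ : ∀ c → ∑ (λ x → 𝟙 (x ≟ c)) ≡ 1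
  ∑-𝟙-≟ c = trans (∑-𝟙-unique (_≟ c) c id) (𝟙-yes (c ≟ c) refl)

  ∑-𝟙-none : {P : Pred Carrier ℓ₁} (P? : Decidable P) → (∀ x → ¬ P x) → ∑ (𝟙 ∘ P?) ≡ 0
  ∑-𝟙-none P? ∄P = trans (∑-cong (λ x → 𝟙-no (P? x) (∄P x))) (trans (∑-const 0) (ℕₚ.*-zeroʳ q))

  ∑³ : (Carrier → Carrier → Carrier → ℕ) → ℕ
  ∑³ f = ∑ λ x → ∑ λ y → ∑ λ z → f x y z

  ∑³-cong : ∀ {f g} → (∀ x y z → f x y z ≡ g x y z) → ∑³ f ≡ ∑³ g
  ∑³-cong f≡g = ∑-cong λ x → ∑-cong λ y → ∑-cong λ z → f≡g x y z

  sumˡ-elements : ∀ f → sumˡ (List.map f elements) ≡ ∑ f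
  sumˡ-elements f =
    trans (cong sumˡ (sym (Listₚ.map-∘ {g = f} {f = fromFin} (List.allFin q)))) (sumˡ-map-tabulate (f ∘ fromFin) id)

  sumˡ-elements³ : ∀ f →
    sumˡ (List.map (λ x → sumˡ (List.map (λ y → sumˡ (List.map (f x y) elements)) elements)) elements) ≡ ∑³ f
  sumˡ-elements³ f =
    trans (sumˡ-elements (λ x → sumˡ (List.map (λ y → sumˡ (List.map (f x y) elements)) elements)))
          (∑-cong λ x → trans (sumˡ-elements (λ y → sumˡ (List.map (f x y) elements)))
                              (∑-cong λ y → sumˡ-elements (f x y)))

  sumˡ-allVec3 : ∀ f → sumˡ (List.map f allVec3) ≡ ∑³ (λ x y z → f (x ∷ y ∷ z ∷ []))
  sumˡ-allVec3 f =
    trans (sumˡ-map-triples elements (λ x y z → x ∷ y ∷ z ∷ []) f)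
          (sumˡ-elements³ (λ x y z → f (x ∷ y ∷ z ∷ [])))

  module ∏Sum = MonoidSum *-commutativeMonoid
  open FiniteSum enum *-commutativeMonoid
    using () renaming (⨁ to ∏; ⨁-cong to ∏-cong; ⨁-distrib to ∏-distrib; ⨁-single to ∏-single; ⨁-bijection to ∏-bijection)

  ^′-+ : ∀ x m n → x ^′ (m ℕ.+ n) ≡ x ^′ m * x ^′ n
  ^′-+ x zero n = sym (*-identityˡ _)
  ^′-+ x (suc m) n = trans (cong (x *_) (^′-+ x m n)) (sym (*-assoc x _ _))

  *-^′ : ∀ x y n → (x * y) ^′ n ≡ x ^′ n * y ^′ n
  *-^′ x y zero = sym (*-identityˡ 1#)
  *-^′ x y (suc n) = trans (cong (x * y *_) (*-^′ x y n)) (interchange x y (x ^′ n) (y ^′ n))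
    where
    interchange : ∀ a b c d → a * b * (c * d) ≡ a * c * (b * d)
    interchange = solve 4 (λ a b c d → a ⊗ b ⊗ (c ⊗ d) ⊜ (a ⊗ c ⊗ (b ⊗ d))) refl

  product-const : ∀ n x → ∏Sum.sum {n} (λ _ → x) ≡ x ^′ n
  product-const zero x = refl
  product-const (suc n) x = cong (x *_) (product-const n x)

  product-≢0 : ∀ {n} (t : Vector Carrier n) → (∀ i → t i ≢ 0#) → ∏Sum.sum t ≢ 0#
  product-≢0 {zero} t _ = 1≢0
  product-≢0 {suc n} t t≢0 = x≢0∧y≢0⇒x*y≢0 (t≢0 zero) (product-≢0 (t ∘ suc) (t≢0 ∘ suc))

  ifZero : Carrier → Carrier → Carrier → Carrier
  ifZero x y z = if does (x ≟ 0#) then y else z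

  ifZero-yes : ∀ {x} y z → x ≡ 0# → ifZero x y z ≡ y
  ifZero-yes {x} y z x≡0 rewrite dec-true (x ≟ 0#) x≡0 = refl

  ifZero-no : ∀ {x} y z → x ≢ 0# → ifZero x y z ≡ z
  ifZero-no {x} y z x≢0 rewrite dec-false (x ≟ 0#) x≢0 = refl

  x*y≡y⇒x≡1 : ∀ {x y} → x * y ≡ y → y ≢ 0# → x ≡ 1#
  x*y≡y⇒x≡1 {x} {y} x*y≡y y≢0 = begin
    x                  ≡⟨ sym (*-identityʳ x) ⟩
    x * 1#             ≡⟨ cong (x *_) (sym (inverse y y≢0)) ⟩
    x * (y * y ⁻¹)     ≡⟨ sym (*-assoc x y (y ⁻¹)) ⟩
    x * y * y ⁻¹       ≡⟨ cong (_* y ⁻¹) x*y≡y ⟩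
    y * y ⁻¹           ≡⟨ inverse y y≢0 ⟩
    1#                 ∎
    where open ≡-Reasoning

  ^′-q≡∏*x : ∀ a → a ^′ q ≡ ∏ (λ x → ifZero x 1# a) * a
  ^′-q≡∏*x a = begin
    a ^′ q                                                ≡⟨ sym (product-const q a) ⟩
    ∏ (λ _ → a)                                           ≡⟨ ∏-cong split ⟩
    ∏ (λ x → ifZero x 1# a * ifZero x a 1#)               ≡⟨ ∏-distrib (λ x → ifZero x 1# a) (λ x → ifZero x a 1#) ⟩
    ∏ (λ x → ifZero x 1# a) * ∏ (λ x → ifZero x a 1#)     ≡⟨ cong (∏ (λ x → ifZero x 1# a) *_) ∏-at-0 ⟩
    ∏ (λ x → ifZero x 1# a) * a                           ∎
    where
    open ≡-Reasoning
    split : ∀ x → a ≡ ifZero x 1# a * ifZero x a 1#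
    split x with x ≟ 0#
    ... | yes x≡0 = sym (trans (cong₂ _*_ (ifZero-yes 1# a x≡0) (ifZero-yes a 1# x≡0)) (*-identityˡ a))
    ... | no x≢0 = sym (trans (cong₂ _*_ (ifZero-no 1# a x≢0) (ifZero-no a 1# x≢0)) (*-identityʳ a))
    ∏-at-0 : ∏ (λ x → ifZero x a 1#) ≡ a
    ∏-at-0 = trans (∏-single 0# _ (λ x x≢0 → ifZero-no a 1# x≢0)) (ifZero-yes a 1# refl)

  ifZero-1-≢0 : ∀ x → ifZero x 1# x ≢ 0#
  ifZero-1-≢0 x with x ≟ 0#
  ... | yes x≡0 = subst (_≢ 0#) (sym (ifZero-yes 1# x x≡0)) 1≢0
  ... | no x≢0 = subst (_≢ 0#) (sym (ifZero-no 1# x x≢0)) x≢0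

  ∏-scaling : ∀ {a} → a ≢ 0# → ∏ (λ x → ifZero x 1# a) * ∏ (λ x → ifZero x 1# x) ≡ ∏ (λ x → ifZero x 1# x)
  ∏-scaling {a} a≢0 = begin
    ∏ (λ x → ifZero x 1# a) * ∏ (λ x → ifZero x 1# x)   ≡⟨ sym (∏-distrib (λ x → ifZero x 1# a) (λ x → ifZero x 1# x)) ⟩
    ∏ (λ x → ifZero x 1# a * ifZero x 1# x)             ≡⟨ ∏-cong scale ⟩
    ∏ (λ x → ifZero (a * x) 1# (a * x))                 ≡⟨ sym (∏-bijection a*-↔ (λ x → ifZero x 1# x)) ⟩
    ∏ (λ x → ifZero x 1# x)                             ∎
    where
    open ≡-Reasoning
    a*-↔ : Carrier ↔ Carrier
    a*-↔ = mk↔ₛ′ (a *_) (a ⁻¹ *_) (x*[x⁻¹*y]≡y a≢0) (x⁻¹*[x*y]≡y a≢0)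
    scale : ∀ x → ifZero x 1# a * ifZero x 1# x ≡ ifZero (a * x) 1# (a * x)
    scale x with x ≟ 0#
    ... | yes x≡0 = begin
      ifZero x 1# a * ifZero x 1# x     ≡⟨ cong₂ _*_ (ifZero-yes 1# a x≡0) (ifZero-yes 1# x x≡0) ⟩
      1# * 1#                           ≡⟨ *-identityˡ 1# ⟩
      1#                                ≡⟨ sym (ifZero-yes 1# (a * x) (trans (cong (a *_) x≡0) (zeroʳ a))) ⟩
      ifZero (a * x) 1# (a * x)         ∎
    ... | no x≢0 = begin
      ifZero x 1# a * ifZero x 1# x     ≡⟨ cong₂ _*_ (ifZero-no 1# a x≢0) (ifZero-no 1# x x≢0) ⟩
      a * x                             ≡⟨ sym (ifZero-no 1# (a * x) (x≢0∧y≢0⇒x*y≢0 a≢0 x≢0)) ⟩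
      ifZero (a * x) 1# (a * x)         ∎

  -- Multiplying by a ≠ 0 permutes F, so it fixes the nonzero product ∏ₓ (ifZero x 1 x);
  -- it also rescales that product by ∏ₓ (ifZero x 1 a), which must therefore be 1.
  fermat : ∀ a → a ^′ q ≡ a
  fermat a with a ≟ 0#
  ... | yes refl = trans (^′-q≡∏*x 0#) (zeroʳ _)
  ... | no a≢0 = begin
    a ^′ q                        ≡⟨ ^′-q≡∏*x a ⟩
    ∏ (λ x → ifZero x 1# a) * a   ≡⟨ cong (_* a) (x*y≡y⇒x≡1 (∏-scaling a≢0) (product-≢0 _ (ifZero-1-≢0 ∘ fromFin))) ⟩
    1# * a                        ≡⟨ *-identityˡ a ⟩
    a                             ∎
    where open ≡-Reasoning

  -- Polynomial functions in Horner form: f x ≡ x * g x + c with g of lower degree.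
  Poly< : ℕ → (Carrier → Carrier) → Set
  Poly< zero f = ∀ x → f x ≡ 0#
  Poly< (suc n) f = ∃₂ λ g c → Poly< n g × (∀ x → f x ≡ x * g x + c)

  Monic : ℕ → (Carrier → Carrier) → Set
  Monic zero f = ∀ x → f x ≡ 1#
  Monic (suc d) f = ∃₂ λ g c → Monic d g × (∀ x → f x ≡ x * g x + c)

  c≡x*0+c : ∀ x c → c ≡ x * 0# + c
  c≡x*0+c x c = sym (trans (cong (_+ c) (zeroʳ x)) (+-identityˡ c))

  horner-+ : ∀ x a b c d → (x * a + c) + (x * b + d) ≡ x * (a + b) + (c + d)
  horner-+ = solve 5 (λ x a b c d → (x ⊗ a ⊕ c) ⊕ (x ⊗ b ⊕ d) ⊜ (x ⊗ (a ⊕ b) ⊕ (c ⊕ d))) refl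

  Poly<-zero : ∀ n {f} → (∀ x → f x ≡ 0#) → Poly< n f
  Poly<-zero zero f≡0 = f≡0
  Poly<-zero (suc n) f≡0 =
    (λ _ → 0#) , 0# , Poly<-zero n (λ _ → refl) , λ x → trans (f≡0 x) (c≡x*0+c x 0#)

  Poly<-≤ : ∀ {m n f} → m ≤ n → Poly< m f → Poly< n f
  Poly<-≤ {n = n} z≤n f≡0 = Poly<-zero n f≡0
  Poly<-≤ (s≤s m≤n) (g , c , g-poly , f≡) = g , c , Poly<-≤ m≤n g-poly , f≡

  Poly<-+ : ∀ n {f g} → Poly< n f → Poly< n g → Poly< n (λ x → f x + g x)
  Poly<-+ zero f≡0 g≡0 x = trans (cong₂ _+_ (f≡0 x) (g≡0 x)) (+-identityʳ 0#)
  Poly<-+ (suc n) (f′ , c , f′-poly , f≡) (g′ , d , g′-poly , g≡) =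
    (λ x → f′ x + g′ x) , c + d , Poly<-+ n f′-poly g′-poly ,
    λ x → trans (cong₂ _+_ (f≡ x) (g≡ x)) (horner-+ x (f′ x) (g′ x) c d)

  Poly<-^′ : ∀ m → Poly< (suc m) (_^′ m)
  Poly<-^′ zero = (λ _ → 0#) , 1# , (λ _ → refl) , λ x → c≡x*0+c x 1#
  Poly<-^′ (suc m) = (_^′ m) , 0# , Poly<-^′ m , λ x → sym (+-identityʳ _)

  Monic-^′ : ∀ m → Monic m (_^′ m)
  Monic-^′ zero _ = refl
  Monic-^′ (suc m) = (_^′ m) , 0# , Monic-^′ m , λ x → sym (+-identityʳ _)

  Monic-+ˡ : ∀ m {f g} → Poly< m g → Monic m f → Monic m (λ x → g x + f x)
  Monic-+ˡ zero g≡0 f≡1 x = trans (cong₂ _+_ (g≡0 x) (f≡1 x)) (+-identityˡ 1#)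
  Monic-+ˡ (suc m) (g′ , d , g′-poly , g≡) (f′ , c , f′-monic , f≡) =
    (λ x → g′ x + f′ x) , d + c , Monic-+ˡ m g′-poly f′-monic ,
    λ x → trans (cong₂ _+_ (g≡ x) (f≡ x)) (horner-+ x (g′ x) (f′ x) d c)

  Monic-quadratic : ∀ b c → Monic 2 (λ x → x * (x + b) + c)
  Monic-quadratic b c =
    (λ x → x + b) , c , ((λ _ → 1#) , b , (λ _ → refl) , λ x → cong (_+ b) (sym (*-identityʳ x))) , λ _ → refl

  divide-by-x+a : ∀ x a G A c → (x + a) * (x * G + A) + (a * A + c) ≡ x * ((x + a) * G + A) + c
  divide-by-x+a x a G A c = begin
    (x + a) * (x * G + A) + (a * A + c)              ≡⟨ expand x a G A c ⟩
    x * ((x + a) * G + A) + c + (a * A + a * A)      ≡⟨ cong (x * ((x + a) * G + A) + c +_) (x+x≡0 (a * A)) ⟩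
    x * ((x + a) * G + A) + c + 0#                   ≡⟨ +-identityʳ _ ⟩
    x * ((x + a) * G + A) + c                        ∎
    where
    open ≡-Reasoning
    expand : ∀ x a G A c → (x + a) * (x * G + A) + (a * A + c) ≡ x * ((x + a) * G + A) + c + (a * A + a * A)
    expand = solve 5 (λ x a G A c → (x ⊕ a) ⊗ (x ⊗ G ⊕ A) ⊕ (a ⊗ A ⊕ c)
                                    ⊜ (x ⊗ ((x ⊕ a) ⊗ G ⊕ A) ⊕ c ⊕ (a ⊗ A ⊕ a ⊗ A))) refl

  factor : ∀ d {f} → Monic (suc d) f → ∀ a → ∃ λ h → Monic d h × (∀ x → f x ≡ (x + a) * h x + f a)
  factor zero {f} (g , c , g≡1 , f≡) a = g , g≡1 , λ x → begin
    f x                                       ≡⟨ f≡ x ⟩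
    x * g x + c                               ≡⟨ cong (λ v → x * v + c) (g≡z*0+1 x (x + a)) ⟩
    x * ((x + a) * 0# + 1#) + c               ≡⟨ sym (divide-by-x+a x a 0# 1# c) ⟩
    (x + a) * (x * 0# + 1#) + (a * 1# + c)    ≡⟨ cong₂ (λ u v → (x + a) * u + (a * v + c)) (sym (g≡z*0+1 x x)) (sym (g≡1 a)) ⟩
    (x + a) * g x + (a * g a + c)             ≡⟨ cong ((x + a) * g x +_) (sym (f≡ a)) ⟩
    (x + a) * g x + f a                       ∎
    where
    open ≡-Reasoning
    g≡z*0+1 : ∀ y z → g y ≡ z * 0# + 1#
    g≡z*0+1 y z = trans (g≡1 y) (c≡x*0+c z 1#)
  factor (suc d) {f} (g , c , g-monic , f≡) a with factor d g-monic a
  ... | h , h-monic , g≡ = (λ x → x * h x + g a) , (h , g a , h-monic , λ _ → refl) , λ x → begin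
    f x                                           ≡⟨ f≡ x ⟩
    x * g x + c                                   ≡⟨ cong (λ v → x * v + c) (g≡ x) ⟩
    x * ((x + a) * h x + g a) + c                 ≡⟨ sym (divide-by-x+a x a (h x) (g a) c) ⟩
    (x + a) * (x * h x + g a) + (a * g a + c)     ≡⟨ cong ((x + a) * (x * h x + g a) +_) (sym (f≡ a)) ⟩
    (x + a) * (x * h x + g a) + f a               ∎
    where open ≡-Reasoning

  roots-≤ : ∀ d {f} → Monic d f → ∑ (λ x → 𝟙 (f x ≟ 0#)) ≤ d
  roots-≤ zero {f} f≡1 = ℕₚ.≤-reflexive (∑-𝟙-none (λ x → f x ≟ 0#) (λ x fx≡0 → 0≢1 (trans (sym fx≡0) (f≡1 x))))
  roots-≤ (suc d) {f} f-monic with ∃? (λ x → f x ≟ 0#)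
  ... | no ∄root = ℕₚ.≤-trans (ℕₚ.≤-reflexive (∑-𝟙-none (λ x → f x ≟ 0#) (λ x fx≡0 → ∄root (x , fx≡0)))) z≤n
  ... | yes (a , fa≡0) with factor d f-monic a
  ...   | h , h-monic , f≡ = begin
    ∑ (λ x → 𝟙 (f x ≟ 0#))
      ≤⟨ ∑-mono-≤ (λ x → 𝟙-≤-+ (root-or-root x) (f x ≟ 0#) (x ≟ a) (h x ≟ 0#)) ⟩
    ∑ (λ x → 𝟙 (x ≟ a) ℕ.+ 𝟙 (h x ≟ 0#))
      ≡⟨ ∑-distrib (λ x → 𝟙 (x ≟ a)) (λ x → 𝟙 (h x ≟ 0#)) ⟩
    ∑ (λ x → 𝟙 (x ≟ a)) ℕ.+ ∑ (λ x → 𝟙 (h x ≟ 0#))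
      ≡⟨ cong (ℕ._+ _) (∑-𝟙-≟ a) ⟩
    suc (∑ (λ x → 𝟙 (h x ≟ 0#)))
      ≤⟨ s≤s (roots-≤ d h-monic) ⟩
    suc d
      ∎
    where
    open ℕₚ.≤-Reasoning
    root-or-root : ∀ x → f x ≡ 0# → x ≡ a ⊎ h x ≡ 0#
    root-or-root x fx≡0 = map₁ x+y≡0⇒x≡y (x*y≡0⇒x≡0⊎y≡0 (
      trans (sym (+-identityʳ _)) (trans (cong ((x + a) * h x +_) (sym fa≡0)) (trans (sym (f≡ x)) fx≡0))))

module Trace {r : ℕ} (F : GF (suc r)) where
  open GF F
  open FiniteField F

  ^′-2^-suc : ∀ x k → x ^′ (2 ℕ.^ suc k) ≡ x ^′ (2 ℕ.^ k) * x ^′ (2 ℕ.^ k)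
  ^′-2^-suc x k =
    trans (^′-+ x (2 ℕ.^ k) (2 ℕ.^ k ℕ.+ 0)) (cong (λ m → x ^′ (2 ℕ.^ k) * x ^′ m) (ℕₚ.+-identityʳ (2 ℕ.^ k)))

  √ : Carrier → Carrier
  √ x = x ^′ (2 ℕ.^ r)

  √x*√x≡x : ∀ x → √ x * √ x ≡ x
  √x*√x≡x x = trans (sym (^′-2^-suc x r)) (fermat x)

  x+y*y≡0⇒y≡√x : ∀ {x y} → x + y * y ≡ 0# → y ≡ √ x
  x+y*y≡0⇒y≡√x {x} x+y²≡0 = x*x≡y*y⇒x≡y (trans (sym (x+y≡0⇒x≡y x+y²≡0)) (sym (√x*√x≡x x)))

  x+√x*√x≡0 : ∀ x → x + √ x * √ x ≡ 0#
  x+√x*√x≡0 x = trans (cong (x +_) (√x*√x≡x x)) (x+x≡0 x)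

  +-^′-2^ : ∀ k x y → (x + y) ^′ (2 ℕ.^ k) ≡ x ^′ (2 ℕ.^ k) + y ^′ (2 ℕ.^ k)
  +-^′-2^ zero x y = distribʳ 1# x y
  +-^′-2^ (suc k) x y = begin
    (x + y) ^′ (2 ℕ.^ suc k)                        ≡⟨ ^′-2^-suc (x + y) k ⟩
    (x + y) ^′ (2 ℕ.^ k) * (x + y) ^′ (2 ℕ.^ k)     ≡⟨ cong₂ _*_ (+-^′-2^ k x y) (+-^′-2^ k x y) ⟩
    (x′ + y′) * (x′ + y′)                           ≡⟨ [x+y]²≡x²+y² x′ y′ ⟩
    x′ * x′ + y′ * y′                               ≡⟨ sym (cong₂ _+_ (^′-2^-suc x k) (^′-2^-suc y k)) ⟩
    x ^′ (2 ℕ.^ suc k) + y ^′ (2 ℕ.^ suc k)         ∎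
    where
    open ≡-Reasoning
    x′ = x ^′ (2 ℕ.^ k)
    y′ = y ^′ (2 ℕ.^ k)

  trUpTo-+ : ∀ k x y → trUpTo k (x + y) ≡ trUpTo k x + trUpTo k y
  trUpTo-+ zero x y = sym (+-identityʳ 0#)
  trUpTo-+ (suc k) x y =
    trans (cong₂ _+_ (trUpTo-+ k x y) (+-^′-2^ k x y)) (interchange _ _ _ _)
    where
    interchange : ∀ a b c d → a + b + (c + d) ≡ a + c + (b + d)
    interchange = solve 4 (λ a b c d → a ⊕ b ⊕ (c ⊕ d) ⊜ (a ⊕ c ⊕ (b ⊕ d))) refl

  trUpTo-square : ∀ k y → trUpTo k (y * y) + y ≡ trUpTo k y + y ^′ (2 ℕ.^ k)
  trUpTo-square zero y = cong (0# +_) (sym (*-identityʳ y))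
  trUpTo-square (suc k) y = begin
    trUpTo k (y * y) + (y * y) ^′ (2 ℕ.^ k) + y     ≡⟨ swap _ _ y ⟩
    trUpTo k (y * y) + y + (y * y) ^′ (2 ℕ.^ k)     ≡⟨ cong₂ _+_ (trUpTo-square k y) square-power ⟩
    trUpTo k y + y ^′ (2 ℕ.^ k) + y ^′ (2 ℕ.^ suc k) ∎
    where
    open ≡-Reasoning
    swap : ∀ a b c → a + b + c ≡ a + c + b
    swap = solve 3 (λ a b c → a ⊕ b ⊕ c ⊜ (a ⊕ c ⊕ b)) refl
    square-power : (y * y) ^′ (2 ℕ.^ k) ≡ y ^′ (2 ℕ.^ suc k)
    square-power = trans (*-^′ y y (2 ℕ.^ k)) (sym (^′-2^-suc y k))

  tr-square : ∀ y → tr (y * y) ≡ tr y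
  tr-square y = begin
    tr (y * y)        ≡⟨ x+y≡z⇒x≡z+y (trans (trUpTo-square (suc r) y) (cong (tr y +_) (fermat y))) ⟩
    tr y + y + y      ≡⟨ +-assoc (tr y) y y ⟩
    tr y + (y + y)    ≡⟨ cong (tr y +_) (x+x≡0 y) ⟩
    tr y + 0#         ≡⟨ +-identityʳ (tr y) ⟩
    tr y              ∎
    where open ≡-Reasoning

  ℘ : Carrier → Carrier
  ℘ y = y * (y + 1#)

  tr-℘ : ∀ y → tr (℘ y) ≡ 0#
  tr-℘ y = begin
    tr (y * (y + 1#))       ≡⟨ cong tr (trans (distribˡ y y 1#) (cong (y * y +_) (*-identityʳ y))) ⟩
    tr (y * y + y)          ≡⟨ trUpTo-+ (suc r) (y * y) y ⟩
    tr (y * y) + tr y       ≡⟨ cong (_+ tr y) (tr-square y) ⟩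
    tr y + tr y             ≡⟨ x+x≡0 (tr y) ⟩
    0#                      ∎
    where open ≡-Reasoning

  trUpTo-Poly< : ∀ k → Poly< (2 ℕ.^ k) (trUpTo k)
  trUpTo-Poly< zero = Poly<-zero 1 (λ _ → refl)
  trUpTo-Poly< (suc k) =
    Poly<-+ (2 ℕ.^ suc k) (Poly<-≤ (ℕₚ.m≤m+n (2 ℕ.^ k) _) (trUpTo-Poly< k))
                          (Poly<-≤ (ℕₚ.m<m+n (2 ℕ.^ k) 2^k+0>0) (Poly<-^′ (2 ℕ.^ k)))
    where
    2^k+0>0 : 2 ℕ.^ k ℕ.+ 0 ℕ.> 0
    2^k+0>0 = ℕₚ.≤-trans (ℕₚ.m^n>0 2 k) (ℕₚ.m≤m+n (2 ℕ.^ k) 0)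

  tr-Monic : Monic (2 ℕ.^ r) tr
  tr-Monic = Monic-+ˡ (2 ℕ.^ r) (trUpTo-Poly< r) (Monic-^′ (2 ℕ.^ r))

  ker-tr-≤ : ∑ (λ x → 𝟙 (tr x ≟ 0#)) ≤ 2 ℕ.^ r
  ker-tr-≤ = roots-≤ (2 ℕ.^ r) tr-Monic

  ℘-fibre-≤ : ∀ x → ∑ (λ y → 𝟙 (℘ y ≟ x)) ≤ 2 ℕ.* 𝟙 (tr x ≟ 0#)
  ℘-fibre-≤ x with tr x ≟ 0#
  ... | yes tr≡0 = begin
    ∑ (λ y → 𝟙 (℘ y ≟ x))          ≡⟨ ∑-cong (λ y → sym (𝟙-cong x+y≡0⇔x≡y (℘ y + x ≟ 0#) (℘ y ≟ x))) ⟩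
    ∑ (λ y → 𝟙 (℘ y + x ≟ 0#))     ≤⟨ roots-≤ 2 (Monic-quadratic 1# x) ⟩
    2 ℕ.* 1                        ≡⟨ cong (2 ℕ.*_) (sym (𝟙-yes (tr x ≟ 0#) tr≡0)) ⟩
    2 ℕ.* 𝟙 (tr x ≟ 0#)            ∎
    where open ℕₚ.≤-Reasoning
  ... | no tr≢0 = ℕₚ.≤-trans (ℕₚ.≤-reflexive (∑-𝟙-none (λ y → ℘ y ≟ x) ℘y≢x)) z≤n
    where
    ℘y≢x : ∀ y → ℘ y ≢ x
    ℘y≢x y ℘y≡x = tr≢0 (trans (cong tr (sym ℘y≡x)) (tr-℘ y))

  ∑-℘-fibres : ∑ (λ x → ∑ (λ y → 𝟙 (℘ y ≟ x))) ≡ q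
  ∑-℘-fibres = begin
    ∑ (λ x → ∑ (λ y → 𝟙 (℘ y ≟ x)))    ≡⟨ ∑-comm (λ x y → 𝟙 (℘ y ≟ x)) ⟩
    ∑ (λ y → ∑ (λ x → 𝟙 (℘ y ≟ x)))    ≡⟨ ∑-cong (λ y → trans (∑-𝟙-unique (℘ y ≟_) (℘ y) sym)
                                                             (𝟙-yes (℘ y ≟ ℘ y) refl)) ⟩
    ∑ (λ _ → 1)                        ≡⟨ ∑-const 1 ⟩
    q ℕ.* 1                            ≡⟨ ℕₚ.*-identityʳ q ⟩
    q                                  ∎
    where open ≡-Reasoning

  -- ℘ is at most two-to-one into the kernel of tr, which has at most q/2 elements
  -- by the degree bound; the fibres cover all q elements, so none can be empty.
  ℘-surjective : ∀ c → tr c ≡ 0# → ∃ λ y → ℘ y ≡ c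
  ℘-surjective c tr≡0 with ∃? (λ y → ℘ y ≟ c)
  ... | yes found = found
  ... | no ∄y = ⊥-elim (ℕₚ.<-irrefl refl q<q)
    where
    open ℕₚ.≤-Reasoning
    empty-fibre : ∑ (λ y → 𝟙 (℘ y ≟ c)) < 2 ℕ.* 𝟙 (tr c ≟ 0#)
    empty-fibre = begin-strict
      ∑ (λ y → 𝟙 (℘ y ≟ c))    ≡⟨ ∑-𝟙-none (λ y → ℘ y ≟ c) (λ y ℘y≡c → ∄y (y , ℘y≡c)) ⟩
      0                        <⟨ s≤s z≤n ⟩
      2 ℕ.* 1                  ≡⟨ cong (2 ℕ.*_) (sym (𝟙-yes (tr c ≟ 0#) tr≡0)) ⟩
      2 ℕ.* 𝟙 (tr c ≟ 0#)      ∎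
    q<q : q < q
    q<q = begin-strict
      q                                  ≡⟨ sym ∑-℘-fibres ⟩
      ∑ (λ x → ∑ (λ y → 𝟙 (℘ y ≟ x)))    <⟨ ∑-mono-< ℘-fibre-≤ c empty-fibre ⟩
      ∑ (λ x → 2 ℕ.* 𝟙 (tr x ≟ 0#))      ≡⟨ ∑-* 2 (λ x → 𝟙 (tr x ≟ 0#)) ⟩
      2 ℕ.* ∑ (λ x → 𝟙 (tr x ≟ 0#))      ≤⟨ ℕₚ.*-monoʳ-≤ 2 ker-tr-≤ ⟩
      q                                  ∎

module QuadraticRoots {r : ℕ} (F : GF (suc r)) where
  open GF F
  open FiniteField F
  open Trace F using (℘; tr-℘; tr-square; ℘-surjective)

  quadraticRoots : Carrier → ℕ
  quadraticRoots t = ∑ (λ a → 𝟙 (a * (a + t) ≟ 1#))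

  quadraticRoots-0 : quadraticRoots 0# ≡ 1
  quadraticRoots-0 = trans (∑-𝟙-unique (λ a → a * (a + 0#) ≟ 1#) 1# a≡1) (𝟙-yes (1# * (1# + 0#) ≟ 1#) 1-root)
    where
    a*[a+0]≡a*a : ∀ a → a * (a + 0#) ≡ a * a
    a*[a+0]≡a*a a = cong (a *_) (+-identityʳ a)
    a≡1 : ∀ {a} → a * (a + 0#) ≡ 1# → a ≡ 1#
    a≡1 {a} a²≡1 = x*x≡y*y⇒x≡y (trans (sym (a*[a+0]≡a*a a)) (trans a²≡1 (sym (*-identityʳ 1#))))
    1-root : 1# * (1# + 0#) ≡ 1#
    1-root = trans (a*[a+0]≡a*a 1#) (*-identityʳ 1#)

  module _ {t : Carrier} (t≢0 : t ≢ 0#) where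
    private
      u = t ⁻¹

    ℘[u*a] : ∀ a → ℘ (u * a) ≡ u * u * (a * (a + t))
    ℘[u*a] a = begin
      u * a * (u * a + 1#)           ≡⟨ cong (λ v → u * a * (u * a + v)) (sym (trans (*-comm u t) (inverse t t≢0))) ⟩
      u * a * (u * a + u * t)        ≡⟨ regroup u a t ⟩
      u * u * (a * (a + t))          ∎
      where
      open ≡-Reasoning
      regroup : ∀ u a t → u * a * (u * a + u * t) ≡ u * u * (a * (a + t))
      regroup = solve 3 (λ u a t → u ⊗ a ⊗ (u ⊗ a ⊕ u ⊗ t) ⊜ (u ⊗ u ⊗ (a ⊗ (a ⊕ t)))) refl

    -- A root a gives ℘ (a / t) = 1 / t², and tr (1 / t²) = tr (1 / t).
    quadraticRoots-tr≡1 : tr u ≡ 1# → quadraticRoots t ≡ 0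
    quadraticRoots-tr≡1 tr≡1 = ∑-𝟙-none (λ a → a * (a + t) ≟ 1#) (λ a root → 0≢1 (trans (sym (tr≡0 a root)) tr≡1))
      where
      tr≡0 : ∀ a → a * (a + t) ≡ 1# → tr u ≡ 0#
      tr≡0 a root = begin
        tr u                    ≡⟨ sym (tr-square u) ⟩
        tr (u * u)              ≡⟨ cong tr (sym (trans (℘[u*a] a) (trans (cong (u * u *_) root) (*-identityʳ _)))) ⟩
        tr (℘ (u * a))          ≡⟨ tr-℘ (u * a) ⟩
        0#                      ∎
        where open ≡-Reasoning

    -- If ℘ y = 1 / t², the two roots are t y and t y + t.
    quadraticRoots-tr≡0 : tr u ≡ 0# → quadraticRoots t ≡ 2
    quadraticRoots-tr≡0 tr≡0 with ℘-surjective (u * u) (trans (tr-square u) tr≡0)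
    ... | y , ℘y≡u² = ℕₚ.≤-antisym at-most-2 at-least-2
      where
      a₀ = t * y
      a₁ = a₀ + t

      a₀-root : a₀ * (a₀ + t) ≡ 1#
      a₀-root = begin
        t * y * (t * y + t)         ≡⟨ cong (λ v → t * y * (t * y + v)) (sym (*-identityʳ t)) ⟩
        t * y * (t * y + t * 1#)    ≡⟨ regroup t y 1# ⟩
        t * t * ℘ y                 ≡⟨ cong (t * t *_) ℘y≡u² ⟩
        t * t * (u * u)             ≡⟨ interchange t t u u ⟩
        t * u * (t * u)             ≡⟨ cong₂ _*_ (inverse t t≢0) (inverse t t≢0) ⟩
        1# * 1#                     ≡⟨ *-identityʳ 1# ⟩
        1#                          ∎
        where
        open ≡-Reasoning
        regroup : ∀ t y o → t * y * (t * y + t * o) ≡ t * t * (y * (y + o))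
        regroup = solve 3 (λ t y o → t ⊗ y ⊗ (t ⊗ y ⊕ t ⊗ o) ⊜ (t ⊗ t ⊗ (y ⊗ (y ⊕ o)))) refl
        interchange : ∀ a b c d → a * b * (c * d) ≡ a * c * (b * d)
        interchange = solve 4 (λ a b c d → a ⊗ b ⊗ (c ⊗ d) ⊜ (a ⊗ c ⊗ (b ⊗ d))) refl

      a₁+t≡a₀ : a₁ + t ≡ a₀
      a₁+t≡a₀ = trans (+-assoc a₀ t t) (trans (cong (a₀ +_) (x+x≡0 t)) (+-identityʳ a₀))

      a₁-root : a₁ * (a₁ + t) ≡ 1#
      a₁-root = trans (cong (a₁ *_) a₁+t≡a₀) (trans (*-comm a₁ a₀) a₀-root)

      a₀≢a₁ : a₀ ≢ a₁
      a₀≢a₁ a₀≡a₁ = t≢0 (begin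
        t                 ≡⟨ sym (+-identityˡ t) ⟩
        0# + t            ≡⟨ cong (_+ t) (sym (x+x≡0 a₀)) ⟩
        a₀ + a₀ + t       ≡⟨ +-assoc a₀ a₀ t ⟩
        a₀ + a₁           ≡⟨ cong (a₀ +_) (sym a₀≡a₁) ⟩
        a₀ + a₀           ≡⟨ x+x≡0 a₀ ⟩
        0#                ∎)
        where open ≡-Reasoning

      at-most-2 : quadraticRoots t ≤ 2
      at-most-2 = begin
        ∑ (λ a → 𝟙 (a * (a + t) ≟ 1#))
          ≡⟨ ∑-cong (λ a → sym (𝟙-cong x+y≡0⇔x≡y (a * (a + t) + 1# ≟ 0#) (a * (a + t) ≟ 1#))) ⟩
        ∑ (λ a → 𝟙 (a * (a + t) + 1# ≟ 0#))
          ≤⟨ roots-≤ 2 (Monic-quadratic t 1#) ⟩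
        2
          ∎
        where open ℕₚ.≤-Reasoning

      at-least-2 : 2 ≤ quadraticRoots t
      at-least-2 = begin
        2
          ≡⟨ sym (cong₂ ℕ._+_ (∑-𝟙-≟ a₀) (∑-𝟙-≟ a₁)) ⟩
        ∑ (λ a → 𝟙 (a ≟ a₀)) ℕ.+ ∑ (λ a → 𝟙 (a ≟ a₁))
          ≡⟨ sym (∑-distrib (λ a → 𝟙 (a ≟ a₀)) (λ a → 𝟙 (a ≟ a₁))) ⟩
        ∑ (λ a → 𝟙 (a ≟ a₀) ℕ.+ 𝟙 (a ≟ a₁))
          ≤⟨ ∑-mono-≤ (λ a → 𝟙-+-≤ (λ { refl → a₀-root }) (λ { refl → a₁-root }) (λ { (refl , a≡a₁) → a₀≢a₁ a≡a₁ })
                                   (a * (a + t) ≟ 1#) (a ≟ a₀) (a ≟ a₁)) ⟩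
        ∑ (λ a → 𝟙 (a * (a + t) ≟ 1#))
          ∎
        where open ℕₚ.≤-Reasoning

module OrthogonalGroup {r : ℕ} (F : GF (suc r)) where
  open GF F
  open FiniteField F
  open Trace F using (√; x+y*y≡0⇒y≡√x; x+√x*√x≡0)
  open QuadraticRoots F using (quadraticRoots)

  matrix : (a b e₁ c d e₂ g h e₃ : Carrier) → Mat3
  matrix a b e₁ c d e₂ g h e₃ = (a ∷ b ∷ e₁ ∷ []) ∷ (c ∷ d ∷ e₂ ∷ []) ∷ (g ∷ h ∷ e₃ ∷ []) ∷ []

  n≡∑ : ∀ β → n β ≡ ∑³ λ a b e₁ → ∑³ λ c d e₂ → ∑³ λ g h e₃ →
                        𝟙 (InO3Tr? β (matrix a b e₁ c d e₂ g h e₃))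
  n≡∑ β =
    trans (length-filter≡sumˡ-𝟙 (InO3Tr? β) allMat3)
          (trans (sumˡ-map-triples allVec3 (λ u v w → u ∷ v ∷ w ∷ []) (𝟙 ∘ InO3Tr? β))
                 (trans (sumˡ-allVec3 (λ u → sumˡ (List.map (λ v → sumˡ (List.map (rows u v) allVec3)) allVec3)))
                        (∑³-cong λ a b e₁ →
                           trans (sumˡ-allVec3 (λ v → sumˡ (List.map (rows (a ∷ b ∷ e₁ ∷ []) v) allVec3)))
                                 (∑³-cong λ c d e₂ → sumˡ-allVec3 (rows (a ∷ b ∷ e₁ ∷ []) (c ∷ d ∷ e₂ ∷ []))))))
    where
    rows : Vec Carrier 3 → Vec Carrier 3 → Vec Carrier 3 → ℕ
    rows u v w = 𝟙 (InO3Tr? β (u ∷ v ∷ w ∷ []))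

  third-row-determined : ∀ β a b e₁ c d e₂ →
    ∑³ (λ g h e₃ → 𝟙 (InO3Tr? β (matrix a b e₁ c d e₂ g h e₃)))
    ≡ 𝟙 (InO3Tr? β (matrix a b e₁ c d e₂ (√ (a * c)) (√ (b * d)) 1#))
  third-row-determined β a b e₁ c d e₂ = begin
    ∑³ (λ g h e₃ → 𝟙 (InO3Tr? β (matrix a b e₁ c d e₂ g h e₃)))
      ≡⟨ ∑-cong (λ g → ∑-cong (λ h → ∑-𝟙-unique (λ e₃ → InO3Tr? β (matrix a b e₁ c d e₂ g h e₃)) 1#
                                                   λ { ((_ , _ , e₃≡1 , _) , _) → e₃≡1 })) ⟩
    ∑ (λ g → ∑ (λ h → 𝟙 (InO3Tr? β (matrix a b e₁ c d e₂ g h 1#))))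
      ≡⟨ ∑-cong (λ g → ∑-𝟙-unique (λ h → InO3Tr? β (matrix a b e₁ c d e₂ g h 1#)) (√ (b * d))
                                    λ { ((_ , _ , _ , _ , bd+h²≡0 , _) , _) → x+y*y≡0⇒y≡√x bd+h²≡0 }) ⟩
    ∑ (λ g → 𝟙 (InO3Tr? β (matrix a b e₁ c d e₂ g (√ (b * d)) 1#)))
      ≡⟨ ∑-𝟙-unique (λ g → InO3Tr? β (matrix a b e₁ c d e₂ g (√ (b * d)) 1#)) (√ (a * c))
                    (λ { ((_ , _ , _ , ac+g²≡0 , _) , _) → x+y*y≡0⇒y≡√x ac+g²≡0 }) ⟩
    𝟙 (InO3Tr? β (matrix a b e₁ c d e₂ (√ (a * c)) (√ (b * d)) 1#))
      ∎
    where open ≡-Reasoning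

  d≡a+[β+e₃] : ∀ {a d e₃ β} → a + d + e₃ ≡ β → d ≡ a + (β + e₃)
  d≡a+[β+e₃] {a} {d} trace≡β =
    trans (x+y≡z⇒x≡z+y (trans (+-comm d a) (x+y≡z⇒x≡z+y trace≡β))) (+-comm _ a)

  first-rows-determined : ∀ β a b →
    ∑ (λ e₁ → ∑³ (λ c d e₂ → 𝟙 (InO3Tr? β (matrix a b e₁ c d e₂ (√ (a * c)) (√ (b * d)) 1#))))
    ≡ ∑ (λ c → 𝟙 (InO3Tr? β (matrix a b 0# c (a + (β + 1#)) 0# (√ (a * c)) (√ (b * (a + (β + 1#)))) 1#)))
  first-rows-determined β a b = begin
    ∑ (λ e₁ → ∑³ (λ c d e₂ → 𝟙 (InO3Tr? β (matrix a b e₁ c d e₂ (√ (a * c)) (√ (b * d)) 1#))))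
      ≡⟨ ∑-cong (λ e₁ → ∑-cong (λ c → ∑-cong (λ d →
           ∑-𝟙-unique (λ e₂ → InO3Tr? β (matrix a b e₁ c d e₂ (√ (a * c)) (√ (b * d)) 1#)) 0#
                      λ { ((_ , e₂≡0 , _) , _) → e₂≡0 }))) ⟩
    ∑ (λ e₁ → ∑ (λ c → ∑ (λ d → 𝟙 (InO3Tr? β (matrix a b e₁ c d 0# (√ (a * c)) (√ (b * d)) 1#)))))
      ≡⟨ ∑-cong (λ e₁ → ∑-cong (λ c →
           ∑-𝟙-unique (λ d → InO3Tr? β (matrix a b e₁ c d 0# (√ (a * c)) (√ (b * d)) 1#)) (a + t)
                      λ { (_ , trace≡β) → d≡a+[β+e₃] trace≡β })) ⟩
    ∑ (λ e₁ → ∑ (λ c → 𝟙 (InO3Tr? β (matrix a b e₁ c (a + t) 0# (√ (a * c)) (√ (b * (a + t))) 1#))))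
      ≡⟨ ∑-comm (λ e₁ c → 𝟙 (InO3Tr? β (matrix a b e₁ c (a + t) 0# (√ (a * c)) (√ (b * (a + t))) 1#))) ⟩
    ∑ (λ c → ∑ (λ e₁ → 𝟙 (InO3Tr? β (matrix a b e₁ c (a + t) 0# (√ (a * c)) (√ (b * (a + t))) 1#))))
      ≡⟨ ∑-cong (λ c →
           ∑-𝟙-unique (λ e₁ → InO3Tr? β (matrix a b e₁ c (a + t) 0# (√ (a * c)) (√ (b * (a + t))) 1#)) 0#
                      λ { ((e₁≡0 , _) , _) → e₁≡0 }) ⟩
    ∑ (λ c → 𝟙 (InO3Tr? β (matrix a b 0# c (a + t) 0# (√ (a * c)) (√ (b * (a + t))) 1#)))
      ∎
    where
    open ≡-Reasoning
    t = β + 1#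

  det-matrix : ∀ a b c d g h → det (matrix a b 0# c d 0# g h 1#) ≡ a * d + b * c
  det-matrix a b c d g h = begin
    det (matrix a b 0# c d 0# g h 1#)
      ≡⟨ cong₂ _+_ (trans (x-y≡x+y _ _) (cong₂ (λ u v → a * u + b * v) (x-y≡x+y _ _) (x-y≡x+y _ _)))
                   (cong (0# *_) (x-y≡x+y _ _)) ⟩
    a * (d * 1# + 0# * h) + b * (c * 1# + 0# * g) + 0# * (c * h + d * g)
      ≡⟨ cong₂ _+_ (cong₂ (λ u v → a * u + b * v) (x*1+0*y≡x d h) (x*1+0*y≡x c g)) (zeroˡ _) ⟩
    a * d + b * c + 0#
      ≡⟨ +-identityʳ _ ⟩
    a * d + b * c
      ∎
    where
    open ≡-Reasoning
    x*1+0*y≡x : ∀ x y → x * 1# + 0# * y ≡ x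
    x*1+0*y≡x x y = trans (cong₂ _+_ (*-identityʳ x) (zeroˡ y)) (+-identityʳ x)

  a+[a+[β+1]]+1≡β : ∀ β a → a + (a + (β + 1#)) + 1# ≡ β
  a+[a+[β+1]]+1≡β β a = begin
    a + (a + (β + 1#)) + 1#        ≡⟨ regroup a β 1# ⟩
    β + (a + a) + (1# + 1#)        ≡⟨ cong₂ (λ u v → β + u + v) (x+x≡0 a) char2 ⟩
    β + 0# + 0#                    ≡⟨ trans (+-identityʳ _) (+-identityʳ β) ⟩
    β                              ∎
    where
    open ≡-Reasoning
    regroup : ∀ a β o → a + (a + (β + o)) + o ≡ β + (a + a) + (o + o)
    regroup = solve 3 (λ a β o → a ⊕ (a ⊕ (β ⊕ o)) ⊕ o ⊜ (β ⊕ (a ⊕ a) ⊕ (o ⊕ o))) refl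

  reduced⇔ad+bc≡1 : ∀ β a b c → let d = a + (β + 1#) in
    InO3Tr β (matrix a b 0# c d 0# (√ (a * c)) (√ (b * d)) 1#) ⇔ (a * d + b * c ≡ 1#)
  reduced⇔ad+bc≡1 β a b c = mk⇔
    (λ { ((_ , _ , _ , _ , _ , ad+bc≡1 , _) , _) → ad+bc≡1 })
    (λ ad+bc≡1 → ( refl , refl , refl , x+√x*√x≡0 (a * c) , x+√x*√x≡0 (b * (a + (β + 1#))) , ad+bc≡1
                 , λ det≡0 → 0≢1 (trans (sym det≡0) (trans (det-matrix a b c _ _ _) ad+bc≡1)))
                 , a+[a+[β+1]]+1≡β β a)

  n≡∑-ad+bc : ∀ β → n β ≡ ∑³ (λ a b c → 𝟙 (a * (a + (β + 1#)) + b * c ≟ 1#))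
  n≡∑-ad+bc β = begin
    n β
      ≡⟨ n≡∑ β ⟩
    ∑³ (λ a b e₁ → ∑³ λ c d e₂ → ∑³ λ g h e₃ → 𝟙 (InO3Tr? β (matrix a b e₁ c d e₂ g h e₃)))
      ≡⟨ ∑³-cong (λ a b e₁ → ∑³-cong (λ c d e₂ → third-row-determined β a b e₁ c d e₂)) ⟩
    ∑ (λ a → ∑ λ b → ∑ λ e₁ → ∑³ λ c d e₂ → 𝟙 (InO3Tr? β (matrix a b e₁ c d e₂ (√ (a * c)) (√ (b * d)) 1#)))
      ≡⟨ ∑-cong (λ a → ∑-cong (λ b → first-rows-determined β a b)) ⟩
    ∑³ (λ a b c → 𝟙 (InO3Tr? β (matrix a b 0# c (a + (β + 1#)) 0# (√ (a * c)) (√ (b * (a + (β + 1#)))) 1#)))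
      ≡⟨ ∑³-cong (λ a b c → 𝟙-cong (reduced⇔ad+bc≡1 β a b c) (InO3Tr? β _) (a * (a + (β + 1#)) + b * c ≟ 1#)) ⟩
    ∑³ (λ a b c → 𝟙 (a * (a + (β + 1#)) + b * c ≟ 1#))
      ∎
    where open ≡-Reasoning

  ∑²-𝟙-b*c≡k : ∀ k → ∑ (λ b → ∑ (λ c → 𝟙 (b * c ≟ k))) ℕ.+ 1 ≡ q ℕ.* 𝟙 (k ≟ 0#) ℕ.+ q
  ∑²-𝟙-b*c≡k k = begin
    ∑ N ℕ.+ 1
      ≡⟨ cong (∑ N ℕ.+_) (sym (∑-𝟙-≟ 0#)) ⟩
    ∑ N ℕ.+ ∑ (λ b → 𝟙 (b ≟ 0#))
      ≡⟨ sym (∑-distrib N (λ b → 𝟙 (b ≟ 0#))) ⟩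
    ∑ (λ b → N b ℕ.+ 𝟙 (b ≟ 0#))
      ≡⟨ ∑-cong N+𝟙[b≡0] ⟩
    ∑ (λ b → X ℕ.* 𝟙 (b ≟ 0#) ℕ.+ 1)
      ≡⟨ ∑-distrib (λ b → X ℕ.* 𝟙 (b ≟ 0#)) (λ _ → 1) ⟩
    ∑ (λ b → X ℕ.* 𝟙 (b ≟ 0#)) ℕ.+ ∑ (λ _ → 1)
      ≡⟨ cong₂ ℕ._+_ (trans (∑-* X (λ b → 𝟙 (b ≟ 0#))) (cong (X ℕ.*_) (∑-𝟙-≟ 0#))) (∑-const 1) ⟩
    X ℕ.* 1 ℕ.+ q ℕ.* 1
      ≡⟨ cong₂ ℕ._+_ (ℕₚ.*-identityʳ X) (ℕₚ.*-identityʳ q) ⟩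
    X ℕ.+ q
      ∎
    where
    open ≡-Reasoning
    N : Carrier → ℕ
    N b = ∑ (λ c → 𝟙 (b * c ≟ k))
    X = q ℕ.* 𝟙 (k ≟ 0#)
    N+𝟙[b≡0] : ∀ b → N b ℕ.+ 𝟙 (b ≟ 0#) ≡ X ℕ.* 𝟙 (b ≟ 0#) ℕ.+ 1
    N+𝟙[b≡0] b with b ≟ 0#
    ... | yes b≡0 = begin
      N b ℕ.+ 𝟙 (b ≟ 0#)              ≡⟨ cong₂ ℕ._+_ N0 (𝟙-yes (b ≟ 0#) b≡0) ⟩
      X ℕ.+ 1                         ≡⟨ cong (ℕ._+ 1) (sym (ℕₚ.*-identityʳ X)) ⟩
      X ℕ.* 1 ℕ.+ 1                   ≡⟨ cong (λ i → X ℕ.* i ℕ.+ 1) (sym (𝟙-yes (b ≟ 0#) b≡0)) ⟩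
      X ℕ.* 𝟙 (b ≟ 0#) ℕ.+ 1          ∎
      where
      b*c≡0 : ∀ c → b * c ≡ 0#
      b*c≡0 c = trans (cong (_* c) b≡0) (zeroˡ c)
      N0 : N b ≡ X
      N0 = trans (∑-cong (λ c → 𝟙-cong (b*c≡k⇔k≡0 c) (b * c ≟ k) (k ≟ 0#))) (∑-const (𝟙 (k ≟ 0#)))
        where
        b*c≡k⇔k≡0 : ∀ c → (b * c ≡ k) ⇔ (k ≡ 0#)
        b*c≡k⇔k≡0 c = mk⇔ (λ bc≡k → trans (sym bc≡k) (b*c≡0 c)) (λ k≡0 → trans (b*c≡0 c) (sym k≡0))
    ... | no b≢0 = begin
      N b ℕ.+ 𝟙 (b ≟ 0#)              ≡⟨ cong₂ ℕ._+_ N1 (𝟙-no (b ≟ 0#) b≢0) ⟩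
      1                               ≡⟨ cong (ℕ._+ 1) (sym (ℕₚ.*-zeroʳ X)) ⟩
      X ℕ.* 0 ℕ.+ 1                   ≡⟨ cong (λ i → X ℕ.* i ℕ.+ 1) (sym (𝟙-no (b ≟ 0#) b≢0)) ⟩
      X ℕ.* 𝟙 (b ≟ 0#) ℕ.+ 1          ∎
      where
      N1 : N b ≡ 1
      N1 = trans (∑-𝟙-unique (λ c → b * c ≟ k) (b ⁻¹ * k)
                             (λ {c} bc≡k → trans (sym (x⁻¹*[x*y]≡y b≢0 c)) (cong (b ⁻¹ *_) bc≡k)))
                 (𝟙-yes (b * (b ⁻¹ * k) ≟ k) (x*[x⁻¹*y]≡y b≢0 k))

  n+q≡q*roots+q² : ∀ β → n β ℕ.+ q ≡ q ℕ.* quadraticRoots (β + 1#) ℕ.+ q ℕ.* q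
  n+q≡q*roots+q² β = begin
    n β ℕ.+ q
      ≡⟨ cong₂ ℕ._+_ (n≡∑-ad+bc β) (sym (trans (∑-const 1) (ℕₚ.*-identityʳ q))) ⟩
    ∑ (λ a → ∑ λ b → ∑ λ c → 𝟙 (Q a + b * c ≟ 1#)) ℕ.+ ∑ (λ _ → 1)
      ≡⟨ sym (∑-distrib (λ a → ∑ λ b → ∑ λ c → 𝟙 (Q a + b * c ≟ 1#)) (λ _ → 1)) ⟩
    ∑ (λ a → ∑ (λ b → ∑ λ c → 𝟙 (Q a + b * c ≟ 1#)) ℕ.+ 1)
      ≡⟨ ∑-cong (λ a → cong (ℕ._+ 1) (∑-cong λ b → ∑-cong λ c →
           𝟙-cong (bc-isolated (Q a) (b * c)) (Q a + b * c ≟ 1#) (b * c ≟ 1# + Q a))) ⟩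
    ∑ (λ a → ∑ (λ b → ∑ λ c → 𝟙 (b * c ≟ 1# + Q a)) ℕ.+ 1)
      ≡⟨ ∑-cong (λ a → ∑²-𝟙-b*c≡k (1# + Q a)) ⟩
    ∑ (λ a → q ℕ.* 𝟙 (1# + Q a ≟ 0#) ℕ.+ q)
      ≡⟨ ∑-cong (λ a → cong (λ i → q ℕ.* i ℕ.+ q) (𝟙-cong (1+x≡0⇔x≡1 (Q a)) (1# + Q a ≟ 0#) (Q a ≟ 1#))) ⟩
    ∑ (λ a → q ℕ.* 𝟙 (Q a ≟ 1#) ℕ.+ q)
      ≡⟨ ∑-distrib (λ a → q ℕ.* 𝟙 (Q a ≟ 1#)) (λ _ → q) ⟩
    ∑ (λ a → q ℕ.* 𝟙 (Q a ≟ 1#)) ℕ.+ ∑ (λ _ → q)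
      ≡⟨ cong₂ ℕ._+_ (∑-* q (λ a → 𝟙 (Q a ≟ 1#))) (∑-const q) ⟩
    q ℕ.* quadraticRoots (β + 1#) ℕ.+ q ℕ.* q
      ∎
    where
    open ≡-Reasoning
    Q : Carrier → Carrier
    Q a = a * (a + (β + 1#))
    bc-isolated : ∀ x y → (x + y ≡ 1#) ⇔ (y ≡ 1# + x)
    bc-isolated x y = mk⇔ (λ x+y≡1 → x+y≡z⇒x≡z+y (trans (+-comm y x) x+y≡1))
                          (λ y≡1+x → trans (+-comm x y) (Equivalence.from x+y≡z⇔x≡z+y y≡1+x))
    1+x≡0⇔x≡1 : ∀ x → (1# + x ≡ 0#) ⇔ (x ≡ 1#)
    1+x≡0⇔x≡1 x = mk⇔ (sym ∘ x+y≡0⇒x≡y) (λ x≡1 → trans (cong (1# +_) x≡1) char2)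

module _ {m q N : ℕ} (m+q≡q*N+q*q : m ℕ.+ q ≡ q ℕ.* N ℕ.+ q ℕ.* q) where
  open +-*-Solver

  N≡1⇒m≡q^2 : N ≡ 1 → m ≡ q ℕ.^ 2
  N≡1⇒m≡q^2 refl = ℕₚ.+-cancelʳ-≡ q m (q ℕ.^ 2)
    (trans m+q≡q*N+q*q (solve 1 (λ q → q :* con 1 :+ q :* q := q :^ 2 :+ q) refl q))

  N≡2⇒m≡q^2+q : N ≡ 2 → m ≡ q ℕ.^ 2 ℕ.+ q
  N≡2⇒m≡q^2+q refl = ℕₚ.+-cancelʳ-≡ q m (q ℕ.^ 2 ℕ.+ q)
    (trans m+q≡q*N+q*q (solve 1 (λ q → q :* con 2 :+ q :* q := q :^ 2 :+ q :+ q) refl q))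

  N≡0⇒m≡q^2∸q : N ≡ 0 → m ≡ q ℕ.^ 2 ℕ.∸ q
  N≡0⇒m≡q^2∸q refl = trans (sym (ℕₚ.m+n∸n≡m m q))
    (cong (ℕ._∸ q) (trans m+q≡q*N+q*q (solve 1 (λ q → q :* con 0 :+ q :* q := q :^ 2) refl q)))

proposition6 : (r : ℕ) → 1 ≤ r → (F : GF r) → (β : GF.Carrier F) →
    let open GF F in
      (β ≡ 1# → n β ≡ q ℕ.^ 2)
    × (β ≢ 1# → tr ((β - 1#) ⁻¹) ≡ 0# → n β ≡ q ℕ.^ 2 ℕ.+ q)
    × (β ≢ 1# → tr ((β - 1#) ⁻¹) ≡ 1# → n β ≡ q ℕ.^ 2 ℕ.∸ q)
proposition6 (suc r) (s≤s _) F β =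
    (λ β≡1 → N≡1⇒m≡q^2 count (trans (cong quadraticRoots (trans (cong (_+ 1#) β≡1) char2)) quadraticRoots-0))
  , (λ β≢1 tr≡0 → N≡2⇒m≡q^2+q count (quadraticRoots-tr≡0 (t≢0 β≢1) (trans (sym tr[β-1]⁻¹≡tr[β+1]⁻¹) tr≡0)))
  , (λ β≢1 tr≡1 → N≡0⇒m≡q^2∸q count (quadraticRoots-tr≡1 (t≢0 β≢1) (trans (sym tr[β-1]⁻¹≡tr[β+1]⁻¹) tr≡1)))
  where
  open GF F
  open FiniteField F using (x+y≡0⇒x≡y; x-y≡x+y)
  open QuadraticRoots F
  open OrthogonalGroup F using (n+q≡q*roots+q²)

  count : n β ℕ.+ q ≡ q ℕ.* quadraticRoots (β + 1#) ℕ.+ q ℕ.* q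
  count = n+q≡q*roots+q² β

  t≢0 : β ≢ 1# → β + 1# ≢ 0#
  t≢0 β≢1 = β≢1 ∘ x+y≡0⇒x≡y

  tr[β-1]⁻¹≡tr[β+1]⁻¹ : tr ((β - 1#) ⁻¹) ≡ tr ((β + 1#) ⁻¹)
  tr[β-1]⁻¹≡tr[β+1]⁻¹ = cong (λ x → tr (x ⁻¹)) (x-y≡x+y β 1#)
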